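{- Let $G$ be a graph of order $n$ such that $G$ and $G^c$ are connected. Then $\operatorname{Sd}_s(G,G^c)=n-1$ if and only if $D(G)=D(G^c)=2$.
   Context: All graphs are finite, simple and undirected; $G^c$ denotes the complement of $G$ on the same vertex set and $D(H)$ the diameter of a connected graph $H$. For a connected graph $H$, $d_H(x,y)$ is the length of a shortest $x$–$y$ path; a vertex $w$ strongly resolves $u,v$ if $d_H(u,w)=d_H(u,v)+d_H(v,w)$ or $d_H(v,w)=d_H(v,u)+d_H(u,w)$; a set $S\subseteq V(H)$ is a strong metric generator for $H$ if every two distinct vertices are strongly resolved by some vertex of $S$. For connected graphs $G_1,\dots,G_k$ on a common vertex set $V$, $\operatorname{Sd}_s(G_1,\dots,G_k)$ is the minimum cardinality of a set $S\subseteq V$ that is a strong metric generator for every $G_i$. -}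

module Defs where

open import Data.Nat using (ℕ; zero; suc; _+_; _≤_)
open import Data.Bool using (Bool; true; false; not; _∧_; T)
open import Data.Fin using (Fin; _≟_)
open import Data.Fin.Subset using (Subset; _∈_; ∣_∣)
open import Data.Product using (Σ; ∃; ∃-syntax; _×_; _,_)
open import Data.Sum using (_⊎_)
open import Relation.Nullary using (¬_; does)
open import Relation.Binary.PropositionalEquality using (_≡_)

record Graph (n : ℕ) : Set where
  field
    adj    : Fin n → Fin n → Bool
    sym    : ∀ x y → adj x y ≡ adj y x
    irrefl : ∀ x → adj x x ≡ false
open Graph public

Adj : ∀ {n} → Graph n → Fin n → Fin n → Set
Adj G x y = T (adj G x y)

complement : ∀ {n} → Graph n → Graph n
complement {n} G = record { adj = a ; sym = s ; irrefl = i }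
  where
  a : Fin n → Fin n → Bool
  a x y = not (adj G x y) ∧ not (does (x ≟ y))
  s : ∀ x y → a x y ≡ a y x
  s x y rewrite Graph.sym G x y with x ≟ y | y ≟ x
  ... | Relation.Nullary.yes _ | Relation.Nullary.yes _ = Relation.Binary.PropositionalEquality.refl
  ... | Relation.Nullary.no _  | Relation.Nullary.no _  = Relation.Binary.PropositionalEquality.refl
  ... | Relation.Nullary.yes p | Relation.Nullary.no q  = Data.Empty.⊥-elim (q (Relation.Binary.PropositionalEquality.sym p))
    where import Data.Empty
  ... | Relation.Nullary.no q  | Relation.Nullary.yes p = Data.Empty.⊥-elim (q (Relation.Binary.PropositionalEquality.sym p))
    where import Data.Empty
  i : ∀ x → a x x ≡ false
  i x with x ≟ x
  ... | Relation.Nullary.yes _ = Data.Bool.Properties.∧-zeroʳ (not (adj G x x))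
    where import Data.Bool.Properties
  ... | Relation.Nullary.no ¬p = Data.Empty.⊥-elim (¬p Relation.Binary.PropositionalEquality.refl)
    where import Data.Empty

data Walk {n : ℕ} (G : Graph n) : Fin n → Fin n → ℕ → Set where
  nil  : ∀ {x} → Walk G x x zero
  cons : ∀ {x y z k} → Adj G x y → Walk G y z k → Walk G x z (suc k)

Connected : ∀ {n} → Graph n → Set
Connected G = ∀ x y → ∃[ k ] Walk G x y k

IsDist : ∀ {n} → Graph n → Fin n → Fin n → ℕ → Set
IsDist G x y k = Walk G x y k × (∀ m → Walk G x y m → k ≤ m)

HasDiameter : ∀ {n} → Graph n → ℕ → Set
HasDiameter G d =
  (∀ x y → ∃[ k ] (IsDist G x y k × k ≤ d)) × (∃[ x ] ∃[ y ] IsDist G x y d)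

StronglyResolves : ∀ {n} → Graph n → Fin n → Fin n → Fin n → Set
StronglyResolves G w u v =
  ∃[ a ] ∃[ b ] ∃[ c ]
    (IsDist G u w a × IsDist G u v b × IsDist G v w c ×
      (a ≡ b + c ⊎ c ≡ b + a))

IsStrongMetricGenerator : ∀ {n} → Graph n → Subset n → Set
IsStrongMetricGenerator G S =
  ∀ u v → ¬ (u ≡ v) → ∃[ w ] (w ∈ S × StronglyResolves G w u v)

SimulStrongDim₂ : ∀ {n} → Graph n → Graph n → ℕ → Set
SimulStrongDim₂ G₁ G₂ k =
  (∃[ S ] (IsStrongMetricGenerator G₁ S × IsStrongMetricGenerator G₂ S × ∣ S ∣ ≡ k))
  × (∀ S → IsStrongMetricGenerator G₁ S → IsStrongMetricGenerator G₂ S → k ≤ ∣ S ∣)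

-- A pair at distance d in a graph of diameter at most d is strongly resolved only by its own
-- endpoints. If G and Gᶜ both have all distances at most 2, every pair of distinct vertices is
-- non-adjacent, hence at distance 2, in one of them, so a simultaneous strong metric generator
-- misses at most one vertex; conversely V ∖ {v} always is one. If instead a geodesic x – p – q – r
-- of length 3 exists in G (say), then r resolves x, q in G, and also in Gᶜ, where xq, xr are edges
-- and qr is not; so V ∖ {x, q} is a simultaneous generator of size n − 2. Diameter exactly 2 then
-- comes from any edge of the other graph.
module Submission where

open import Defs hiding (sym)
open import Data.Nat using (ℕ; zero; suc; _+_; _≤_; _<_; _∸_; z≤n; s≤s)
open import Data.Nat.Properties
  using ( ≤-refl; ≤-trans; ≤-antisym; ≮⇒≥; <⇒≱; m<1+n⇒m<n∨m≡n; n≤0⇒n≡0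
        ; +-cancelˡ-≤; +-cancelʳ-≤; +-monoʳ-≤; +-comm; +-identityʳ
        ; ∸-monoˡ-≤; ∸-monoʳ-<; m≤n+m∸n; m+n∸n≡m; module ≤-Reasoning )
open import Data.Bool using (T; true; false)
open import Data.Bool.Properties using (T?)
open import Data.Fin using (Fin; _≟_) renaming (zero to fzero; suc to fsuc)
open import Data.Fin.Properties using (any?)
open import Data.Fin.Subset using (Subset; _∈_; _∉_; ∣_∣; ∁; ⁅_⁆; _∪_; _⊆_)
open import Data.Fin.Subset.Properties
  using ( _∈?_; nonempty?; Empty-unique; ∣⊥∣≡0; ∣⁅x⁆∣≡1; ∣∁p∣≡n∸∣p∣; ∣p∣≤n
        ; x∈⁅x⁆; x∈⁅y⁆⇒x≡y; x∈∁p⇒x∉p; x∉∁p⇒x∈p; x∉p⇒x∈∁p; x∈p∪q⁻; x∈p∪q⁺; p⊆p∪q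
        ; p⊆q⇒∣p∣≤∣q∣; p⊂q⇒∣p∣<∣q∣ )
open import Data.Product using (∃-syntax; _×_; _,_; proj₁; proj₂)
open import Data.Sum using (_⊎_; inj₁; inj₂; [_,_])
open import Data.Empty using (⊥; ⊥-elim)
open import Relation.Nullary using (¬_; Dec; yes; no)
open import Relation.Nullary.Decidable using (_×-dec_)
open import Relation.Binary.PropositionalEquality using (_≡_; _≢_; refl; sym; trans; cong; subst; ≢-sym)
open import Function.Bundles using (_⇔_; mk⇔)

Least : (ℕ → Set) → ℕ → Set
Least P m = P m × (∀ j → P j → m ≤ j)

module _ {P : ℕ → Set} (P? : ∀ m → Dec (P m)) where

  least-or-absent : ∀ b → (∃[ m ] Least P m) ⊎ (∀ j → j < b → ¬ P j)
  least-or-absent zero = inj₂ λ _ ()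
  least-or-absent (suc b) with least-or-absent b | P? b
  ... | inj₁ found | _      = inj₁ found
  ... | inj₂ absent | yes pb = inj₁ (b , pb , λ j pj → ≮⇒≥ λ j<b → absent j j<b pj)
  ... | inj₂ absent | no ¬pb = inj₂ absent′
    where
    absent′ : ∀ j → j < suc b → ¬ P j
    absent′ j j<1+b with m<1+n⇒m<n∨m≡n j<1+b
    ... | inj₁ j<b  = absent j j<b
    ... | inj₂ refl = ¬pb

  least : ∀ {k} → P k → ∃[ m ] Least P m
  least {k} pk with least-or-absent (suc k)
  ... | inj₁ found  = found
  ... | inj₂ absent = ⊥-elim (absent k ≤-refl pk)

m∸n≤o⇒m∸o≤n : ∀ m n o → m ∸ n ≤ o → m ∸ o ≤ n
m∸n≤o⇒m∸o≤n m n o m∸n≤o = begin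
  m ∸ o       ≤⟨ ∸-monoˡ-≤ o (≤-trans (m≤n+m∸n m n) (+-monoʳ-≤ n m∸n≤o)) ⟩
  (n + o) ∸ o ≡⟨ m+n∸n≡m n o ⟩
  n           ∎
  where open ≤-Reasoning

m+n≤m⇒n≡0 : ∀ m n → m + n ≤ m → n ≡ 0
m+n≤m⇒n≡0 m n m+n≤m = n≤0⇒n≡0 (+-cancelˡ-≤ m n 0 (subst (m + n ≤_) (sym (+-identityʳ m)) m+n≤m))

module _ {n : ℕ} where

  ∉∁⁅x⁆∪⁅y⁆⇒ : ∀ {u} (x y : Fin n) → u ∉ ∁ (⁅ x ⁆ ∪ ⁅ y ⁆) → u ≡ x ⊎ u ≡ y
  ∉∁⁅x⁆∪⁅y⁆⇒ x y u∉ with x∈p∪q⁻ ⁅ x ⁆ ⁅ y ⁆ (x∉∁p⇒x∈p u∉)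
  ... | inj₁ u∈⁅x⁆ = inj₁ (x∈⁅y⁆⇒x≡y x u∈⁅x⁆)
  ... | inj₂ u∈⁅y⁆ = inj₂ (x∈⁅y⁆⇒x≡y y u∈⁅y⁆)

  ∈∁⁅x⁆∪⁅y⁆ : ∀ {u x y : Fin n} → u ≢ x → u ≢ y → u ∈ ∁ (⁅ x ⁆ ∪ ⁅ y ⁆)
  ∈∁⁅x⁆∪⁅y⁆ {u} {x} {y} u≢x u≢y = x∉p⇒x∈∁p λ u∈ →
    [ (λ u∈⁅x⁆ → u≢x (x∈⁅y⁆⇒x≡y x u∈⁅x⁆)) , (λ u∈⁅y⁆ → u≢y (x∈⁅y⁆⇒x≡y y u∈⁅y⁆)) ]
      (x∈p∪q⁻ ⁅ x ⁆ ⁅ y ⁆ u∈)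

  2≤∣⁅x⁆∪⁅y⁆∣ : ∀ {x y : Fin n} → x ≢ y → 2 ≤ ∣ ⁅ x ⁆ ∪ ⁅ y ⁆ ∣
  2≤∣⁅x⁆∪⁅y⁆∣ {x} {y} x≢y = subst (λ k → suc k ≤ ∣ ⁅ x ⁆ ∪ ⁅ y ⁆ ∣) (∣⁅x⁆∣≡1 x)
    (p⊂q⇒∣p∣<∣q∣ (p⊆p∪q ⁅ y ⁆ , y , x∈p∪q⁺ (inj₂ (x∈⁅x⁆ y)) , λ y∈⁅x⁆ → x≢y (sym (x∈⁅y⁆⇒x≡y x y∈⁅x⁆))))

  subsingleton⇒∣p∣≤1 : ∀ (p : Subset n) → (∀ {u v} → u ∈ p → v ∈ p → u ≡ v) → ∣ p ∣ ≤ 1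
  subsingleton⇒∣p∣≤1 p unique with nonempty? p
  ... | no empty = subst (_≤ 1) (sym (trans (cong ∣_∣ (Empty-unique empty)) (∣⊥∣≡0 n))) z≤n
  ... | yes (x , x∈p) = subst (∣ p ∣ ≤_) (∣⁅x⁆∣≡1 x) (p⊆q⇒∣p∣≤∣q∣ p⊆⁅x⁆)
    where
    p⊆⁅x⁆ : p ⊆ ⁅ x ⁆
    p⊆⁅x⁆ u∈p = subst (_∈ ⁅ x ⁆) (unique x∈p u∈p) (x∈⁅x⁆ x)

  outsideSubsingleton⇒n∸1≤∣p∣ : ∀ (p : Subset n) → (∀ {u v} → u ≢ v → u ∉ p → v ∉ p → ⊥) → n ∸ 1 ≤ ∣ p ∣
  outsideSubsingleton⇒n∸1≤∣p∣ p no-two = m∸n≤o⇒m∸o≤n n ∣ p ∣ 1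
    (subst (_≤ 1) (∣∁p∣≡n∸∣p∣ p) (subsingleton⇒∣p∣≤1 (∁ p) unique))
    where
    unique : ∀ {u v} → u ∈ ∁ p → v ∈ ∁ p → u ≡ v
    unique {u} {v} u∈ v∈ with u ≟ v
    ... | yes u≡v = u≡v
    ... | no u≢v  = ⊥-elim (no-two u≢v (x∈∁p⇒x∉p u∈) (x∈∁p⇒x∉p v∈))

  ∣∁⁅x⁆∪⁅y⁆∣<n∸1 : ∀ {x y : Fin n} → x ≢ y → ∣ ∁ (⁅ x ⁆ ∪ ⁅ y ⁆) ∣ < n ∸ 1
  ∣∁⁅x⁆∪⁅y⁆∣<n∸1 {x} {y} x≢y = subst (_< n ∸ 1) (sym (∣∁p∣≡n∸∣p∣ (⁅ x ⁆ ∪ ⁅ y ⁆)))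
    (∸-monoʳ-< (2≤∣⁅x⁆∪⁅y⁆∣ x≢y) (∣p∣≤n (⁅ x ⁆ ∪ ⁅ y ⁆)))

  ∣∁⁅x⁆∣≡n∸1 : ∀ (x : Fin n) → ∣ ∁ ⁅ x ⁆ ∣ ≡ n ∸ 1
  ∣∁⁅x⁆∣≡n∸1 x = trans (∣∁p∣≡n∸∣p∣ ⁅ x ⁆) (cong (n ∸_) (∣⁅x⁆∣≡1 x))

module _ {n : ℕ} (G : Graph n) where

  Adj-sym : ∀ {x y} → Adj G x y → Adj G y x
  Adj-sym {x} {y} = subst T (Graph.sym G x y)

  Adj⇒≢ : ∀ {x y} → Adj G x y → x ≢ y
  Adj⇒≢ {x} x~x refl = subst T (irrefl G x) x~x

  infixr 5 _++ʷ_
  _++ʷ_ : ∀ {x y z m k} → Walk G x y m → Walk G y z k → Walk G x z (m + k)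
  nil       ++ʷ q = q
  cons e p ++ʷ q = cons e (p ++ʷ q)

  reverseʷ : ∀ {x y m} → Walk G x y m → Walk G y x m
  reverseʷ nil = nil
  reverseʷ {m = suc m} (cons e p) =
    subst (Walk G _ _) (+-comm m 1) (reverseʷ p ++ʷ cons (Adj-sym e) nil)

  Walk-length0⇒≡ : ∀ {x y} → Walk G x y 0 → x ≡ y
  Walk-length0⇒≡ nil = refl

  walk? : ∀ m x y → Dec (Walk G x y m)
  walk? zero x y with x ≟ y
  ... | yes refl = yes nil
  ... | no x≢y   = no λ p → x≢y (Walk-length0⇒≡ p)
  walk? (suc m) x y with any? (λ z → T? (adj G x z) ×-dec walk? m z y)
  ... | yes (z , e , p) = yes (cons e p)
  ... | no ¬step        = no λ { (cons e p) → ¬step (_ , e , p) }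

  IsDist-exists : Connected G → ∀ x y → ∃[ k ] IsDist G x y k
  IsDist-exists connected x y = least (λ m → walk? m x y) (proj₂ (connected x y))

  IsDist-sym : ∀ {x y k} → IsDist G x y k → IsDist G y x k
  IsDist-sym (p , shortest) = reverseʷ p , λ m q → shortest m (reverseʷ q)

  IsDist-unique : ∀ {x y k l} → IsDist G x y k → IsDist G x y l → k ≡ l
  IsDist-unique (p , shortest) (q , shortest′) = ≤-antisym (shortest _ q) (shortest′ _ p)

  IsDist-refl : ∀ {x} → IsDist G x x 0
  IsDist-refl = nil , λ _ _ → z≤n

  IsDist0⇒≡ : ∀ {x y} → IsDist G x y 0 → x ≡ y
  IsDist0⇒≡ (p , _) = Walk-length0⇒≡ p

  IsDist-suc⇒≢ : ∀ {x y k} → IsDist G x y (suc k) → x ≢ y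
  IsDist-suc⇒≢ (_ , shortest) refl with shortest 0 nil
  ... | ()

  IsDist-2+⇒¬Adj : ∀ {x y k} → IsDist G x y (2 + k) → ¬ Adj G x y
  IsDist-2+⇒¬Adj (_ , shortest) x~y with shortest 1 (cons x~y nil)
  ... | s≤s ()

  Adj⇒IsDist1 : ∀ {x y} → Adj G x y → IsDist G x y 1
  Adj⇒IsDist1 x~y = cons x~y nil , shortest
    where
    shortest : ∀ m → Walk G _ _ m → 1 ≤ m
    shortest zero    p = ⊥-elim (Adj⇒≢ x~y (Walk-length0⇒≡ p))
    shortest (suc m) _ = s≤s z≤n

  commonNeighbour⇒IsDist2 : ∀ {x y z} → x ≢ y → ¬ Adj G x y → Adj G x z → Adj G z y → IsDist G x y 2
  commonNeighbour⇒IsDist2 x≢y x≁y x~z z~y = cons x~z (cons z~y nil) , shortest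
    where
    shortest : ∀ m → Walk G _ _ m → 2 ≤ m
    shortest zero          p              = ⊥-elim (x≢y (Walk-length0⇒≡ p))
    shortest (suc zero)    (cons x~y nil) = ⊥-elim (x≁y x~y)
    shortest (suc (suc m)) _              = s≤s (s≤s z≤n)

  IsDist-prefix : ∀ {x y z m k} → IsDist G x y (m + k) → Walk G x z m → Walk G z y k → IsDist G x z m
  IsDist-prefix {m = m} {k} (_ , shortest) p q =
    p , λ j r → +-cancelʳ-≤ k m j (shortest (j + k) (r ++ʷ q))

  StronglyResolves-sym : ∀ {w u v} → StronglyResolves G w u v → StronglyResolves G w v u
  StronglyResolves-sym (a , b , c , du , duv , dv , inj₁ a≡b+c) =
    c , b , a , dv , IsDist-sym duv , du , inj₂ a≡b+c
  StronglyResolves-sym (a , b , c , du , duv , dv , inj₂ c≡b+a) =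
    c , b , a , dv , IsDist-sym duv , du , inj₁ c≡b+a

  StronglyResolves-self : ∀ {u v b} → IsDist G u v b → StronglyResolves G u u v
  StronglyResolves-self {b = b} duv =
    0 , b , b , IsDist-refl , duv , IsDist-sym duv , inj₂ (sym (+-identityʳ b))

  generator-fromOutsidePairs : Connected G → (S : Subset n) →
    (∀ u v → u ≢ v → u ∉ S → v ∉ S → ∃[ w ] (w ∈ S × StronglyResolves G w u v)) →
    IsStrongMetricGenerator G S
  generator-fromOutsidePairs connected S outside u v u≢v with u ∈? S | v ∈? S
  ... | yes u∈S | _       = u , u∈S , StronglyResolves-self (proj₂ (IsDist-exists connected u v))
  ... | no _    | yes v∈S =
    v , v∈S , StronglyResolves-sym (StronglyResolves-self (proj₂ (IsDist-exists connected v u)))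
  ... | no u∉S  | no v∉S  = outside u v u≢v u∉S v∉S

  ∁⁅x⁆-generator : Connected G → ∀ x → IsStrongMetricGenerator G (∁ ⁅ x ⁆)
  ∁⁅x⁆-generator connected x = generator-fromOutsidePairs connected (∁ ⁅ x ⁆) λ u v u≢v u∉ v∉ →
    ⊥-elim (u≢v (trans (x∈⁅y⁆⇒x≡y x (x∉∁p⇒x∈p u∉)) (sym (x∈⁅y⁆⇒x≡y x (x∉∁p⇒x∈p v∉)))))

  ∁⁅x⁆∪⁅y⁆-generator : Connected G → ∀ {w x y} → w ∈ ∁ (⁅ x ⁆ ∪ ⁅ y ⁆) → StronglyResolves G w x y →
    IsStrongMetricGenerator G (∁ (⁅ x ⁆ ∪ ⁅ y ⁆))
  ∁⁅x⁆∪⁅y⁆-generator connected {w} {x} {y} w∈S resolves = generator-fromOutsidePairs connected _ outside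
    where
    outside : ∀ u v → u ≢ v → u ∉ ∁ (⁅ x ⁆ ∪ ⁅ y ⁆) → v ∉ ∁ (⁅ x ⁆ ∪ ⁅ y ⁆) →
              ∃[ w ] (w ∈ ∁ (⁅ x ⁆ ∪ ⁅ y ⁆) × StronglyResolves G w u v)
    outside u v u≢v u∉ v∉ with ∉∁⁅x⁆∪⁅y⁆⇒ x y u∉ | ∉∁⁅x⁆∪⁅y⁆⇒ x y v∉
    ... | inj₁ refl | inj₂ refl = w , w∈S , resolves
    ... | inj₂ refl | inj₁ refl = w , w∈S , StronglyResolves-sym resolves
    ... | inj₁ refl | inj₁ refl = ⊥-elim (u≢v refl)
    ... | inj₂ refl | inj₂ refl = ⊥-elim (u≢v refl)

  DistancesBoundedBy : ℕ → Set
  DistancesBoundedBy d = ∀ x y → ∃[ k ] (IsDist G x y k × k ≤ d)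

  module _ {d : ℕ} (bounded : DistancesBoundedBy d) where

    IsDist-bounded : ∀ {x y k} → IsDist G x y k → k ≤ d
    IsDist-bounded {x} {y} dxy with bounded x y
    ... | k , dxy′ , k≤d = subst (_≤ d) (IsDist-unique dxy′ dxy) k≤d

    beyondBound⇒≡ : ∀ {u v w a e} → a ≡ d + e → IsDist G u w a → IsDist G v w e → v ≡ w
    beyondBound⇒≡ {e = e} refl duw dvw rewrite m+n≤m⇒n≡0 d e (IsDist-bounded duw) = IsDist0⇒≡ dvw

    diametral-resolvedOnlyByEnds : ∀ {w x y} → IsDist G x y d → StronglyResolves G w x y → w ≡ x ⊎ w ≡ y
    diametral-resolvedOnlyByEnds dxy (a , b , c , dxw , dxy′ , dyw , eq) rewrite IsDist-unique dxy′ dxy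
      with eq
    ... | inj₁ a≡d+c = inj₂ (sym (beyondBound⇒≡ a≡d+c dxw dyw))
    ... | inj₂ c≡d+a = inj₁ (sym (beyondBound⇒≡ c≡d+a dyw dxw))

  nonadjacent⇒IsDist2 : DistancesBoundedBy 2 → ∀ {x y} → x ≢ y → ¬ Adj G x y → IsDist G x y 2
  nonadjacent⇒IsDist2 bounded {x} {y} x≢y x≁y with bounded x y
  ... | zero , dxy , _                       = ⊥-elim (x≢y (IsDist0⇒≡ dxy))
  ... | suc zero , (cons x~y nil , _) , _    = ⊥-elim (x≁y x~y)
  ... | suc (suc zero) , dxy , _             = dxy
  ... | suc (suc (suc _)) , _ , s≤s (s≤s ())

  generator-meetsNonadjacent : DistancesBoundedBy 2 → ∀ {S} → IsStrongMetricGenerator G S →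
    ∀ {u v} → u ≢ v → ¬ Adj G u v → u ∉ S → v ∉ S → ⊥
  generator-meetsNonadjacent bounded generator {u} {v} u≢v u≁v u∉S v∉S with generator u v u≢v
  ... | w , w∈S , resolves
    with diametral-resolvedOnlyByEnds bounded (nonadjacent⇒IsDist2 bounded u≢v u≁v) resolves
  ... | inj₁ refl = u∉S w∈S
  ... | inj₂ refl = v∉S w∈S

  Connected⇒edge : Connected G → ∀ {x y} → x ≢ y → ∃[ u ] ∃[ v ] Adj G u v
  Connected⇒edge connected {x} {y} x≢y with connected x y
  ... | zero , p            = ⊥-elim (x≢y (Walk-length0⇒≡ p))
  ... | suc _ , cons x~z _  = x , _ , x~z

Complementary : ∀ {n} → Graph n → Graph n → Set
Complementary {n} H K = ∀ {x y : Fin n} → x ≢ y → (Adj H x y → ¬ Adj K x y) × (¬ Adj H x y → Adj K x y)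

complement-complementary : ∀ {n} (G : Graph n) → Complementary G (complement G)
complement-complementary G {x} {y} x≢y with adj G x y | x ≟ y
... | _     | yes x≡y = ⊥-elim (x≢y x≡y)
... | true  | no _    = (λ _ ()) , λ x≁y → ⊥-elim (x≁y _)
... | false | no _    = (λ ()) , _

Complementary-sym : ∀ {n} {H K : Graph n} → Complementary H K → Complementary K H
Complementary-sym {H = H} {K} complementary {x} {y} x≢y =
  (λ x~y x~′y → proj₁ (complementary x≢y) x~′y x~y) , reconstruct (T? (adj H x y))
  where
  reconstruct : Dec (Adj H x y) → ¬ Adj K x y → Adj H x y
  reconstruct (yes x~y) _     = x~y
  reconstruct (no x≁y)  x≁′y = ⊥-elim (x≁′y (proj₂ (complementary x≢y) x≁y))

SimultaneousGenerator : ∀ {n} → Graph n → Graph n → Subset n → Set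
SimultaneousGenerator H K S = IsStrongMetricGenerator H S × IsStrongMetricGenerator K S

module _ {n : ℕ} {H K : Graph n} (complementary : Complementary H K)
         (connectedH : Connected H) (connectedK : Connected K) where

  -- In K, x ~ y and x ~ z but y ≁ z, so x lies on a y–z geodesic and z again resolves x, y.
  geodesic3⇒simultaneousGenerator : ∀ {x y z} → IsDist H x y 2 → Adj H y z → IsDist H x z 3 →
    SimultaneousGenerator H K (∁ (⁅ x ⁆ ∪ ⁅ y ⁆))
  geodesic3⇒simultaneousGenerator dxy y~z dxz =
      ∁⁅x⁆∪⁅y⁆-generator H connectedH z∈S (3 , 2 , 1 , dxz , dxy , Adj⇒IsDist1 H y~z , inj₁ refl)
    , ∁⁅x⁆∪⁅y⁆-generator K connectedK z∈S
        (1 , 1 , 2 , Adj⇒IsDist1 K x~′z , Adj⇒IsDist1 K x~′y , dK-yz , inj₂ refl)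
    where
    x≢y = IsDist-suc⇒≢ H dxy
    x≢z = IsDist-suc⇒≢ H dxz
    y≢z = Adj⇒≢ H y~z
    z∈S = ∈∁⁅x⁆∪⁅y⁆ (≢-sym x≢z) (≢-sym y≢z)
    x~′y = proj₂ (complementary x≢y) (IsDist-2+⇒¬Adj H dxy)
    x~′z = proj₂ (complementary x≢z) (IsDist-2+⇒¬Adj H dxz)
    dK-yz = commonNeighbour⇒IsDist2 K y≢z (proj₁ (complementary y≢z) y~z) (Adj-sym K x~′y) x~′z

  module _ (minimal : ∀ S → SimultaneousGenerator H K S → n ∸ 1 ≤ ∣ S ∣) where

    ¬IsDist3+ : ∀ {x y j} → ¬ IsDist H x y (3 + j)
    ¬IsDist3+ {x} dxy@(cons x~p (cons {y = q} p~q (cons q~r rest)) , _) =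
      <⇒≱ (∣∁⁅x⁆∪⁅y⁆∣<n∸1 {x = x} {y = q} (IsDist-suc⇒≢ H dxq))
          (minimal _ (geodesic3⇒simultaneousGenerator dxq q~r dxr))
      where
      dxq = IsDist-prefix H dxy (cons x~p (cons p~q nil)) (cons q~r rest)
      dxr = IsDist-prefix H dxy (cons x~p (cons p~q (cons q~r nil))) rest

    distancesBoundedBy2 : DistancesBoundedBy H 2
    distancesBoundedBy2 x y with IsDist-exists H connectedH x y
    ... | zero , dxy                = 0 , dxy , z≤n
    ... | suc zero , dxy            = 1 , dxy , s≤s z≤n
    ... | suc (suc zero) , dxy      = 2 , dxy , ≤-refl
    ... | suc (suc (suc _)) , dxy   = ⊥-elim (¬IsDist3+ dxy)

    diameter2 : ∀ {x₀ y₀ : Fin n} → x₀ ≢ y₀ → HasDiameter H 2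
    diameter2 x₀≢y₀ with Connected⇒edge K connectedK x₀≢y₀
    ... | u , v , u~′v = distancesBoundedBy2 , u , v , nonadjacent⇒IsDist2 H distancesBoundedBy2 u≢v u≁v
      where
      u≢v = Adj⇒≢ K u~′v
      u≁v = proj₁ (Complementary-sym {H = H} {K} complementary u≢v) u~′v

module _ {n : ℕ} {H K : Graph n} (complementary : Complementary H K)
         (boundedH : DistancesBoundedBy H 2) (boundedK : DistancesBoundedBy K 2) where

  -- Every pair is non-adjacent in H or in K, hence diametral there.
  simultaneousGenerator-size : ∀ S → SimultaneousGenerator H K S → n ∸ 1 ≤ ∣ S ∣
  simultaneousGenerator-size S (genH , genK) = outsideSubsingleton⇒n∸1≤∣p∣ S meets
    where
    meets : ∀ {u v} → u ≢ v → u ∉ S → v ∉ S → ⊥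
    meets {u} {v} u≢v with T? (adj H u v)
    ... | yes u~v = generator-meetsNonadjacent K boundedK genK u≢v (proj₁ (complementary u≢v) u~v)
    ... | no u≁v  = generator-meetsNonadjacent H boundedH genH u≢v u≁v

mainTheorem13 : (n : ℕ) → 2 ≤ n → (G : Graph n) → Connected G → Connected (complement G) →
    (SimulStrongDim₂ G (complement G) (n ∸ 1) ⇔ (HasDiameter G 2 × HasDiameter (complement G) 2))
mainTheorem13 (suc zero) (s≤s ())
mainTheorem13 (suc (suc m)) _ G connectedG connectedGᶜ = mk⇔ diameters dimension
  where
  complementary = complement-complementary G
  0≢1 : fzero ≢ fsuc {suc m} fzero
  0≢1 ()

  diameters : SimulStrongDim₂ G (complement G) (suc m) → HasDiameter G 2 × HasDiameter (complement G) 2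
  diameters (_ , minimal) =
      diameter2 complementary connectedG connectedGᶜ (λ S gen → minimal S (proj₁ gen) (proj₂ gen)) 0≢1
    , diameter2 (Complementary-sym {H = G} {complement G} complementary) connectedGᶜ connectedG
                (λ S gen → minimal S (proj₂ gen) (proj₁ gen)) 0≢1

  dimension : HasDiameter G 2 × HasDiameter (complement G) 2 → SimulStrongDim₂ G (complement G) (suc m)
  dimension ((boundedG , _) , (boundedGᶜ , _)) =
      ( ∁ ⁅ fzero ⁆ , ∁⁅x⁆-generator G connectedG fzero , ∁⁅x⁆-generator (complement G) connectedGᶜ fzero
      , ∣∁⁅x⁆∣≡n∸1 fzero )
    , λ S genG genGᶜ → simultaneousGenerator-size complementary boundedG boundedGᶜ S (genG , genGᶜ)
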